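{- There are $2^{\aleph_0}$ different downward closed subsets of $Ob(\mathcal{G})$ (for the quasi-order $G\geq H \iff$ there exists a homomorphism $G\to H$) all of whose elements are graphs of chromatic number greater than $2$.
   Context: A graph is a finite set of vertices with a symmetric binary relation (loops allowed, no multiple edges); homomorphisms are vertex maps sending edges to edges. $\mathcal{G}$ is the category with one representative of each isomorphism class of finite graphs and homomorphisms as morphisms. On $Ob(\mathcal{G})$ define the quasi-order $G\geq H$ iff there exists a homomorphism $G\to H$. A subset $S\subseteq Ob(\mathcal{G})$ is downward closed if $x\in S$ and $x\geq y$ imply $y\in S$. The chromatic number of a graph is the least $k$ such that its vertices can be coloured with $k$ colours so that any two adjacent vertices receive different colours (a graph with a loop admits no such colouring, and its chromatic number is regarded as infinite). -}

module Defs where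

open import Data.Nat using (ℕ)
open import Data.Fin using (Fin)
open import Data.Bool using (Bool; true)
open import Data.Product using (Σ; ∃; _×_)
open import Relation.Binary.PropositionalEquality using (_≡_; _≢_)
open import Relation.Nullary using (¬_)
open import Level using (0ℓ; suc)

record Graph : Set where
  field
    n   : ℕ
    adj : Fin n → Fin n → Bool
    sym : ∀ i j → adj i j ≡ true → adj j i ≡ true
open Graph public

Hom : Graph → Graph → Set
Hom G H = Σ (Fin (n G) → Fin (n H)) λ f →
  ∀ i j → adj G i j ≡ true → adj H (f i) (f j) ≡ true

_≥G_ : Graph → Graph → Set
G ≥G H = Hom G H

GraphSet : Set₁
GraphSet = Graph → Set

DownwardClosed : GraphSet → Set
DownwardClosed S = ∀ G H → S G → G ≥G H → S H

Colourable : ℕ → Graph → Set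
Colourable k G = Σ (Fin (n G) → Fin k) λ c →
  ∀ i j → adj G i j ≡ true → c i ≢ c j

-- chromatic number > k  iff  not k-colourable (graphs with a loop have
-- no colouring, chromatic number ∞).
ChromaticGreaterThan : ℕ → Graph → Set
ChromaticGreaterThan k G = ¬ Colourable k G

SameSet : GraphSet → GraphSet → Set
SameSet S T = ∀ G → (S G → T G) × (T G → S G)

module Submission where

-- The graphs used are the circular complete graphs K_{p/q}: vertices ℤ_p, with
-- x ~ y iff their circular distance is at least q.  The key fact is that, for
-- p ≥ 3q, a homomorphism K_{p/q} → K_{p′/q′} forces p/q ≤ p′/q′.  It is proved by
-- double counting: an independent set of K_{p/q} lies in an arc of length q,
-- and the preimages of the p′ rotations of an arc of length q′ of ℤ_{p′} are
-- independent, cover every vertex q′ times and each have at most q elements.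
--
-- A sequence f : ℕ → Bool is coded as a point of the ternary Cantor set; its
-- truncations give graphs A f k of ratios 3 + (1 + code f k)/3^k decreasing
-- towards that point.  The set DownSet f of all graphs below some A f k is
-- downward closed; its members are not 2-colourable since all ratios exceed 2;
-- and if f, g first differ at k with f k = true, then A g (k+1) has a ratio
-- below every ratio of f, so it lies in DownSet g but not in DownSet f.

open import Defs hiding (sym)
open import Data.Nat
  using (ℕ; zero; suc; _+_; _*_; _∸_; _^_; _≤_; _<_; _⊓_; ∣_-_∣; NonZero; z≤n; s≤s; >-nonZero⁻¹)
open import Data.Nat.Properties
open import Data.Nat.DivMod using (_%_; _mod_; %-distribˡ-+; m<n⇒m%n≡m; [m+n]%n≡m%n)
open import Data.Nat.Induction using (<-rec)
open import Data.Nat.Tactic.RingSolver using (solve-∀)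
open import Algebra.Properties.CommutativeSemigroup +-commutativeSemigroup
  using (interchange; xy∙z≈xz∙y)
open import Data.Fin using (Fin; toℕ)
open import Data.Fin.Properties using (toℕ-fromℕ<; toℕ<n; toℕ-injective)
open import Data.Bool using (Bool; true; false)
open import Data.Bool.Properties using (T-≡)
open import Data.Product using (Σ; ∃; _×_; _,_; proj₁; proj₂)
open import Data.Sum using (_⊎_; inj₁; inj₂; [_,_]′)
open import Data.Empty using (⊥-elim)
open import Function using (_∘_; Equivalence)
open import Relation.Binary.PropositionalEquality
open import Relation.Nullary using (¬_; Dec; yes; no)
open import Relation.Nullary.Decidable using (isYes; toWitness; fromWitness; _×-dec_)

sumN : ℕ → (ℕ → ℕ) → ℕ
sumN zero    h = 0
sumN (suc n) h = sumN n h + h n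

sum-cong : ∀ n {g h : ℕ → ℕ} → (∀ i → i < n → g i ≡ h i) → sumN n g ≡ sumN n h
sum-cong zero    eq = refl
sum-cong (suc n) eq = cong₂ _+_ (sum-cong n (λ i i<n → eq i (m<n⇒m<1+n i<n))) (eq n (n<1+n n))

sum-mono : ∀ n {g h : ℕ → ℕ} → (∀ i → i < n → g i ≤ h i) → sumN n g ≤ sumN n h
sum-mono zero    le = z≤n
sum-mono (suc n) le = +-mono-≤ (sum-mono n (λ i i<n → le i (m<n⇒m<1+n i<n))) (le n (n<1+n n))

sum-const : ∀ n c → sumN n (λ _ → c) ≡ n * c
sum-const zero    c = refl
sum-const (suc n) c = trans (cong (_+ c) (sum-const n c)) (+-comm (n * c) c)

sum-distrib-+ : ∀ n (g h : ℕ → ℕ) → sumN n (λ i → g i + h i) ≡ sumN n g + sumN n h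
sum-distrib-+ zero    g h = refl
sum-distrib-+ (suc n) g h =
  trans (cong (_+ (g n + h n)) (sum-distrib-+ n g h)) (interchange (sumN n g) (sumN n h) (g n) (h n))

sum-swap : ∀ a b (h : ℕ → ℕ → ℕ) →
           sumN a (λ i → sumN b (h i)) ≡ sumN b (λ j → sumN a (λ i → h i j))
sum-swap zero    b h = sym (trans (sum-const b 0) (*-zeroʳ b))
sum-swap (suc a) b h =
  trans (cong (_+ sumN b (h a)) (sum-swap a b h)) (sym (sum-distrib-+ b (λ j → sumN a (λ i → h i j)) (h a)))

sum-unshift : ∀ n (g : ℕ → ℕ) → sumN (suc n) g ≡ g 0 + sumN n (g ∘ suc)
sum-unshift zero    g = +-comm 0 (g 0)
sum-unshift (suc n) g = trans (cong (_+ g (suc n)) (sum-unshift n g)) (+-assoc (g 0) _ _)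

sum-shift : ∀ n (g : ℕ → ℕ) → g n ≡ g 0 → sumN n (g ∘ suc) ≡ sumN n g
sum-shift n g gn≡g0 = +-cancelˡ-≡ (g 0) _ _ (begin
  g 0 + sumN n (g ∘ suc) ≡⟨ sum-unshift n g ⟨
  sumN n g + g n         ≡⟨ cong (sumN n g +_) gn≡g0 ⟩
  sumN n g + g 0         ≡⟨ +-comm (sumN n g) (g 0) ⟩
  g 0 + sumN n g         ∎)
  where open ≡-Reasoning

sum-rotate : ∀ n .{{_ : NonZero n}} (h : ℕ → ℕ) w → sumN n (λ c → h ((w + c) % n)) ≡ sumN n h
sum-rotate n h zero    = sum-cong n (λ i i<n → cong h (m<n⇒m%n≡m i<n))
sum-rotate n h (suc w) = begin
  sumN n (λ c → h ((suc w + c) % n)) ≡⟨ sum-cong n (λ c _ → cong (λ e → h (e % n)) (sym (+-suc w c))) ⟩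
  sumN n (g ∘ suc)                   ≡⟨ sum-shift n g periodic ⟩
  sumN n g                           ≡⟨ sum-rotate n h w ⟩
  sumN n h                           ∎
  where
  open ≡-Reasoning
  g : ℕ → ℕ
  g c = h ((w + c) % n)
  periodic : g n ≡ g 0
  periodic = cong h (trans ([m+n]%n≡m%n w n) (cong (_% n) (sym (+-identityʳ w))))

double-count : ∀ p p′ r s (M : ℕ → ℕ → ℕ) →
               (∀ x → x < p → sumN p′ (M x) ≡ r) →
               (∀ c → c < p′ → sumN p (λ x → M x c) ≤ s) →
               p * r ≤ p′ * s
double-count p p′ r s M rows columns = begin
  p * r                                ≡⟨ sum-const p r ⟨
  sumN p (λ _ → r)                     ≡⟨ sum-cong p rows ⟨
  sumN p (λ x → sumN p′ (M x))         ≡⟨ sum-swap p p′ M ⟩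
  sumN p′ (λ c → sumN p (λ x → M x c)) ≤⟨ sum-mono p′ columns ⟩
  sumN p′ (λ _ → s)                    ≡⟨ sum-const p′ s ⟩
  p′ * s                               ∎
  where open ≤-Reasoning

𝟙 : {A : Set} → Dec A → ℕ
𝟙 (yes _) = 1
𝟙 (no _)  = 0

𝟙-mono : {A B : Set} → (A → B) → (a? : Dec A) (b? : Dec B) → 𝟙 a? ≤ 𝟙 b?
𝟙-mono f (no _)  _        = z≤n
𝟙-mono f (yes _) (yes _)  = ≤-refl
𝟙-mono f (yes a) (no ¬b)  = ⊥-elim (¬b (f a))

count-below : ∀ n q → sumN n (λ c → 𝟙 (c <? q)) ≡ n ⊓ q
count-below zero    q = refl
count-below (suc n) q with n <? q
... | yes n<q = begin
  sumN n (λ c → 𝟙 (c <? q)) + 1 ≡⟨ cong (_+ 1) (count-below n q) ⟩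
  n ⊓ q + 1                     ≡⟨ cong (_+ 1) (m≤n⇒m⊓n≡m (<⇒≤ n<q)) ⟩
  n + 1                         ≡⟨ +-comm n 1 ⟩
  suc n                         ≡⟨ m≤n⇒m⊓n≡m n<q ⟨
  suc n ⊓ q                     ∎
  where open ≡-Reasoning
... | no n≮q = begin
  sumN n (λ c → 𝟙 (c <? q)) + 0 ≡⟨ +-identityʳ _ ⟩
  sumN n (λ c → 𝟙 (c <? q))     ≡⟨ count-below n q ⟩
  n ⊓ q                         ≡⟨ m≥n⇒m⊓n≡n (≮⇒≥ n≮q) ⟩
  q                             ≡⟨ m≥n⇒m⊓n≡n (m≤n⇒m≤1+n (≮⇒≥ n≮q)) ⟨
  suc n ⊓ q                     ∎
  where open ≡-Reasoning

arc-size : ∀ n .{{_ : NonZero n}} q w → q ≤ n → sumN n (λ c → 𝟙 ((w + c) % n <? q)) ≡ q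
arc-size n q w q≤n =
  trans (sum-rotate n (λ x → 𝟙 (x <? q)) w) (trans (count-below n q) (m≥n⇒m⊓n≡n q≤n))

least : {P : ℕ → Set} → (∀ x → Dec (P x)) → ∀ n →
        (∃ λ x → x < n × P x × (∀ y → y < x → ¬ P y)) ⊎ (∀ y → y < n → ¬ P y)
least P? zero = inj₂ (λ y ())
least P? (suc n) with least P? n
... | inj₁ (x , x<n , Px , x-least) = inj₁ (x , m<n⇒m<1+n x<n , Px , x-least)
... | inj₂ none with P? n
...   | yes Pn = inj₁ (n , n<1+n n , Pn , none)
...   | no ¬Pn = inj₂ (λ y y<1+n →
          [ none y , (λ y≡n Py → ¬Pn (subst _ y≡n Py)) ]′ (m<1+n⇒m<n∨m≡n y<1+n))

-- x and y are at circular distance at least q in ℤ_p (for x, y < p).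
CircAdj : ℕ → ℕ → ℕ → ℕ → Set
CircAdj p q x y = q ≤ ∣ x - y ∣ × ∣ x - y ∣ + q ≤ p

circAdj? : ∀ p q x y → Dec (CircAdj p q x y)
circAdj? p q x y = (q ≤? ∣ x - y ∣) ×-dec (∣ x - y ∣ + q ≤? p)

CircAdj-sym : ∀ {p q x y} → CircAdj p q x y → CircAdj p q y x
CircAdj-sym {p} {q} {x} {y} = subst (λ d → q ≤ d × d + q ≤ p) (∣-∣-comm x y)

CircAdj-≤ : ∀ {p q x y} → y ≤ x → CircAdj p q x y ≡ (q ≤ x ∸ y × x ∸ y + q ≤ p)
CircAdj-≤ {p} {q} y≤x = cong (λ d → q ≤ d × d + q ≤ p) (m≤n⇒∣n-m∣≡n∸m y≤x)

wraps-around : ∀ {p q x y} → y ≤ x → q ≤ x ∸ y → ¬ CircAdj p q x y → p < x ∸ y + q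
wraps-around y≤x q≤d ¬adj = ≰⇒> (λ d+q≤p → ¬adj (subst (λ X → X) (sym (CircAdj-≤ y≤x)) (q≤d , d+q≤p)))

module _ (p : ℕ) .{{_ : NonZero p}} where

  shift-in-period : ∀ x d → x % p + d < p → (x + d) % p ≡ x % p + d
  shift-in-period x d lt = begin
    (x + d) % p         ≡⟨ %-distribˡ-+ x d p ⟩
    (x % p + d % p) % p ≡⟨ cong (λ e → (x % p + e) % p) (m<n⇒m%n≡m (≤-<-trans (m≤n+m d (x % p)) lt)) ⟩
    (x % p + d) % p     ≡⟨ m<n⇒m%n≡m lt ⟩
    x % p + d           ∎
    where open ≡-Reasoning

  rotate-window : ∀ q m v → m ≤ v → v < p → v < m + q → (v + (p ∸ m)) % p < q
  rotate-window q m v m≤v v<p v<m+q = subst (_< q) (sym rotated) v∸m<q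
    where
    v∸m<q : v ∸ m < q
    v∸m<q = +-cancelˡ-< m (v ∸ m) q (subst (_< m + q) (sym (m+[n∸m]≡n m≤v)) v<m+q)
    rotated : (v + (p ∸ m)) % p ≡ v ∸ m
    rotated = begin
      (v + (p ∸ m)) % p           ≡⟨ cong (λ e → (e + (p ∸ m)) % p) (m∸n+n≡m m≤v) ⟨
      (v ∸ m + m + (p ∸ m)) % p   ≡⟨ cong (_% p) (+-assoc (v ∸ m) m (p ∸ m)) ⟩
      (v ∸ m + (m + (p ∸ m))) % p ≡⟨ cong (λ e → (v ∸ m + e) % p) (m+[n∸m]≡n (≤-trans m≤v (<⇒≤ v<p))) ⟩
      (v ∸ m + p) % p             ≡⟨ [m+n]%n≡m%n (v ∸ m) p ⟩
      (v ∸ m) % p                 ≡⟨ m<n⇒m%n≡m (≤-<-trans (m∸n≤m v m) v<p) ⟩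
      v ∸ m                       ∎
      where open ≡-Reasoning

  rotate-wrapped : ∀ q m v → q ≤ p → v ≤ m → m < p → p < m ∸ v + q → (v + (p ∸ m)) % p < q
  rotate-wrapped q m v q≤p v≤m m<p p<m∸v+q = subst (_< q) (sym (m<n⇒m%n≡m (<-≤-trans below q≤p))) below
    where
    below : v + (p ∸ m) < q
    below = +-cancelʳ-< m (v + (p ∸ m)) q (begin-strict
      v + (p ∸ m) + m   ≡⟨ +-assoc v (p ∸ m) m ⟩
      v + (p ∸ m + m)   ≡⟨ cong (v +_) (m∸n+n≡m (<⇒≤ m<p)) ⟩
      v + p             <⟨ +-monoʳ-< v p<m∸v+q ⟩
      v + (m ∸ v + q)   ≡⟨ +-assoc v (m ∸ v) q ⟨
      v + (m ∸ v) + q   ≡⟨ cong (_+ q) (m+[n∸m]≡n v≤m) ⟩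
      m + q             ≡⟨ +-comm m q ⟩
      q + m             ∎)
      where open ≤-Reasoning

  -- Two points whose translates by c both lie in the arc [0, q) are not adjacent.
  -- For b ≤ a the translate of a would be that of b plus a ∸ b ≥ q.
  arc-independent-≤ : ∀ q a b c → b ≤ a → (a + c) % p < q → (b + c) % p < q → ¬ CircAdj p q a b
  arc-independent-≤ q a b c b≤a ha hb adj = <⇒≱ ha (begin
    q                 ≤⟨ q≤d ⟩
    d                 ≤⟨ m≤n+m d ((b + c) % p) ⟩
    (b + c) % p + d   ≡⟨ shift-in-period (b + c) d no-wrap ⟨
    (b + c + d) % p   ≡⟨ cong (_% p) a+c≡b+c+d ⟨
    (a + c) % p       ∎)
    where
    open ≤-Reasoning
    d : ℕ
    d = a ∸ b
    q≤d : q ≤ d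
    q≤d = proj₁ (subst (λ X → X) (CircAdj-≤ b≤a) adj)
    d+q≤p : d + q ≤ p
    d+q≤p = proj₂ (subst (λ X → X) (CircAdj-≤ b≤a) adj)
    no-wrap : (b + c) % p + d < p
    no-wrap = <-≤-trans (subst (_< d + q) (+-comm d _) (+-monoʳ-< d hb)) d+q≤p
    a+c≡b+c+d : a + c ≡ b + c + d
    a+c≡b+c+d = trans (cong (_+ c) (sym (m+[n∸m]≡n b≤a))) (xy∙z≈xz∙y b d c)

  arc-independent : ∀ q a b c → (a + c) % p < q → (b + c) % p < q → ¬ CircAdj p q a b
  arc-independent q a b c ha hb adj with ≤-total b a
  ... | inj₁ b≤a = arc-independent-≤ q a b c b≤a ha hb adj
  ... | inj₂ a≤b = arc-independent-≤ q b a c a≤b hb ha (CircAdj-sym {x = a} {y = b} adj)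

  -- Let m ∈ J lie at distance ≥ q after a, with m not adjacent to a (so m is close
  -- to a the other way round) and minimal with these properties.  Then every
  -- v ∈ J lies in [m, p) or in [0, a + q), and rotating by p ∸ m maps it into [0, q).
  arc-around : ∀ q {J : ℕ → Set} → q + q + q ≤ p →
    (∀ x y → x < p → y < p → J x → J y → ¬ CircAdj p q x y) →
    ∀ a m → m < p → J m → a + q ≤ m → p < m ∸ a + q →
    (∀ v → v < m → ¬ (J v × a + q ≤ v)) →
    ∀ v → v < p → J v → (v + (p ∸ m)) % p < q
  arc-around q 3q≤p indep a m m<p Jm a+q≤m p<m∸a+q m-least v v<p Jv with a + q ≤? v
  ... | yes a+q≤v = rotate-window q m v m≤v v<p v<m+q
    where
    m≤v : m ≤ v
    m≤v = ≮⇒≥ (λ v<m → m-least v v<m (Jv , a+q≤v))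
    v<m+q : v < m + q
    v<m+q = <-trans v<p (<-≤-trans p<m∸a+q (+-monoˡ-≤ q (m∸n≤m m a)))
  ... | no a+q≰v = rotate-wrapped q m v q≤p (<⇒≤ v<m) m<p
                     (wraps-around (<⇒≤ v<m) q≤m∸v (indep m v m<p v<p Jm Jv))
    where
    q≤p : q ≤ p
    q≤p = ≤-trans (≤-trans (m≤m+n q q) (m≤m+n (q + q) q)) 3q≤p
    2q<m∸a : q + q < m ∸ a
    2q<m∸a = +-cancelʳ-< q (q + q) (m ∸ a) (≤-<-trans 3q≤p p<m∸a+q)
    v+q<m : v + q < m
    v+q<m = begin-strict
      v + q       <⟨ +-monoˡ-< q (≰⇒> a+q≰v) ⟩
      a + q + q   ≡⟨ +-assoc a q q ⟩
      a + (q + q) <⟨ +-monoʳ-< a 2q<m∸a ⟩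
      a + (m ∸ a) ≡⟨ m+[n∸m]≡n (m+n≤o⇒m≤o a a+q≤m) ⟩
      m           ∎
      where open ≤-Reasoning
    v<m : v < m
    v<m = ≤-<-trans (m≤m+n v q) v+q<m
    q≤m∸v : q ≤ m ∸ v
    q≤m∸v = m+n≤o⇒m≤o∸n q (subst (_≤ m) (+-comm v q) (<⇒≤ v+q<m))

  independent-in-arc : ∀ q → q + q + q ≤ p → {J : ℕ → Set} → (∀ x → Dec (J x)) →
    (∀ x y → x < p → y < p → J x → J y → ¬ CircAdj p q x y) →
    ∃ λ s → ∀ v → v < p → J v → (v + s) % p < q
  independent-in-arc q 3q≤p J? indep with least J? p
  ... | inj₂ empty = 0 , λ v v<p Jv → ⊥-elim (empty v v<p Jv)
  ... | inj₁ (a , a<p , Ja , a-least) with least (λ x → J? x ×-dec (a + q ≤? x)) p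
  ...   | inj₂ none-far = p ∸ a , λ v v<p Jv →
          rotate-window q a v (≮⇒≥ (λ v<a → a-least v v<a Jv)) v<p
            (≰⇒> (λ a+q≤v → none-far v v<p (Jv , a+q≤v)))
  ...   | inj₁ (m , m<p , (Jm , a+q≤m) , m-least) = p ∸ m ,
          arc-around q 3q≤p indep a m m<p Jm a+q≤m p<m∸a+q m-least
    where
    p<m∸a+q : p < m ∸ a + q
    p<m∸a+q = wraps-around (m+n≤o⇒m≤o a a+q≤m) (m+n≤o⇒m≤o∸n q (subst (_≤ m) (+-comm a q) a+q≤m))
                (indep m a m<p a<p Jm Ja)

circAdjᵇ : ℕ → ℕ → ℕ → ℕ → Bool
circAdjᵇ p q x y = isYes (circAdj? p q x y)

circAdjᵇ⇒ : ∀ {p q} x y → circAdjᵇ p q x y ≡ true → CircAdj p q x y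
circAdjᵇ⇒ x y e = toWitness (Equivalence.from T-≡ e)

⇒circAdjᵇ : ∀ {p q} x y → CircAdj p q x y → circAdjᵇ p q x y ≡ true
⇒circAdjᵇ x y xy = Equivalence.to T-≡ (fromWitness xy)

K : ℕ → ℕ → Graph
K p q = record
  { n   = p
  ; adj = λ i j → circAdjᵇ p q (toℕ i) (toℕ j)
  ; sym = λ i j e → ⇒circAdjᵇ (toℕ j) (toℕ i) (CircAdj-sym {x = toℕ i} {y = toℕ j} (circAdjᵇ⇒ (toℕ i) (toℕ j) e))
  }

compose : ∀ G H I → Hom G H → Hom H I → Hom G I
compose G H I (g , g-hom) (h , h-hom) = h ∘ g , λ i j e → h-hom (g i) (g j) (g-hom i j e)

idHom : ∀ G → Hom G G
idHom G = (λ x → x) , λ i j e → e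

onℕ : ∀ {p m} .{{_ : NonZero p}} → (Fin p → Fin m) → ℕ → ℕ
onℕ {p} f x = toℕ (f (x mod p))

toℕ-mod : ∀ {p x} .{{_ : NonZero p}} → x < p → toℕ (x mod p) ≡ x
toℕ-mod x<p = trans (toℕ-fromℕ< _) (m<n⇒m%n≡m x<p)

hom-CircAdj : ∀ {p q p′ q′} .{{_ : NonZero p}} (h : Hom (K p q) (K p′ q′)) →
              ∀ x y → x < p → y < p → CircAdj p q x y → CircAdj p′ q′ (onℕ (proj₁ h) x) (onℕ (proj₁ h) y)
hom-CircAdj {p} {q} {p′} {q′} (f , f-hom) x y x<p y<p xy =
  circAdjᵇ⇒ {p′} {q′} (toℕ (f (x mod p))) (toℕ (f (y mod p))) (f-hom (x mod p) (y mod p)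
    (⇒circAdjᵇ (toℕ (x mod p)) (toℕ (y mod p)) (subst₂ (CircAdj p q) (sym (toℕ-mod x<p)) (sym (toℕ-mod y<p)) xy)))

-- Count pairs (x, c) such that rotation c of ℤ_{p′} moves the
-- image of x into [0, q′): each x is counted q′ times, and for each c the
-- counted x form an independent set, hence lie in an arc and number at most q.
circular-bound : ∀ p q p′ q′ .{{_ : NonZero p}} .{{_ : NonZero p′}} →
                 q + q + q ≤ p → q′ ≤ p′ → Hom (K p q) (K p′ q′) → p * q′ ≤ p′ * q
circular-bound p q p′ q′ 3q≤p q′≤p′ h = double-count p p′ q′ q counted rows columns
  where
  φ : ℕ → ℕ
  φ = onℕ (proj₁ h)
  counted : ℕ → ℕ → ℕ
  counted x c = 𝟙 ((φ x + c) % p′ <? q′)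
  rows : ∀ x → x < p → sumN p′ (counted x) ≡ q′
  rows x _ = arc-size p′ q′ (φ x) q′≤p′
  independent : ∀ c x y → x < p → y < p → (φ x + c) % p′ < q′ → (φ y + c) % p′ < q′ → ¬ CircAdj p q x y
  independent c x y x<p y<p hx hy xy = arc-independent p′ q′ (φ x) (φ y) c hx hy (hom-CircAdj h x y x<p y<p xy)
  q≤p : q ≤ p
  q≤p = ≤-trans (≤-trans (m≤m+n q q) (m≤m+n (q + q) q)) 3q≤p
  columns : ∀ c → c < p′ → sumN p (λ x → counted x c) ≤ q
  columns c _ with independent-in-arc p q 3q≤p (λ x → (φ x + c) % p′ <? q′) (independent c)
  ... | s , in-arc = begin
    sumN p (λ x → counted x c)              ≤⟨ sum-mono p (λ x x<p → 𝟙-mono (rotated x x<p) _ _) ⟩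
    sumN p (λ x → 𝟙 ((s + x) % p <? q))     ≡⟨ arc-size p q s q≤p ⟩
    q                                       ∎
    where
    open ≤-Reasoning
    rotated : ∀ x → x < p → (φ x + c) % p′ < q′ → (s + x) % p < q
    rotated x x<p hit = subst (λ e → e % p < q) (+-comm x s) (in-arc x x<p hit)

colour-pullback : ∀ {k} G H → Hom G H → Colourable k H → Colourable k G
colour-pullback G H (f , f-hom) (c , proper) = c ∘ f , λ i j e → proper (f i) (f j) (f-hom i j e)

colouring⇒hom : ∀ {k} G → Colourable k G → Hom G (K k 1)
colouring⇒hom {k} G (c , proper) = c , λ i j e → ⇒circAdjᵇ (toℕ (c i)) (toℕ (c j)) (distinct⇒adj (proper i j e))
  where
  distinct⇒adj : ∀ {x y : Fin k} → x ≢ y → CircAdj k 1 (toℕ x) (toℕ y)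
  distinct⇒adj {x} {y} x≢y =
    n≢0⇒n>0 (λ d≡0 → x≢y (toℕ-injective (∣m-n∣≡0⇒m≡n d≡0))) ,
    subst (_≤ k) (+-comm 1 _) (≤-<-trans (∣m-n∣≤m⊔n (toℕ x) (toℕ y)) (⊔-lub (toℕ<n x) (toℕ<n y)))

circular-not-colourable : ∀ k p q .{{_ : NonZero k}} .{{_ : NonZero p}} →
                          q + q + q ≤ p → k * q < p → ¬ Colourable k (K p q)
circular-not-colourable k p q 3q≤p kq<p col =
  <⇒≱ kq<p (subst (_≤ k * q) (*-identityʳ p) (circular-bound p q k 1 3q≤p (>-nonZero⁻¹ k) (colouring⇒hom (K p q) col)))

digit : Bool → ℕ
digit true  = 2
digit false = 0

digit≤2 : ∀ b → digit b ≤ 2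
digit≤2 true  = ≤-refl
digit≤2 false = z≤n

-- code f k = Σ_{i<k} digit (f i) · 3^(k-1-i): the first k ternary digits of the
-- point of the Cantor set coded by f.
code : (ℕ → Bool) → ℕ → ℕ
code f zero    = 0
code f (suc k) = 3 * code f k + digit (f k)

code-prefix : ∀ f g k → (∀ i → i < k → f i ≡ g i) → code f k ≡ code g k
code-prefix f g zero    agree = refl
code-prefix f g (suc k) agree =
  cong₂ (λ c b → 3 * c + digit b) (code-prefix f g k (λ i i<k → agree i (m<n⇒m<1+n i<k))) (agree k (n<1+n k))

code-upper : ∀ f m d → suc (code f (m + d)) ≤ 3 ^ d * suc (code f m)
code-upper f m zero rewrite +-identityʳ m = ≤-reflexive (sym (*-identityˡ _))
code-upper f m (suc d) rewrite +-suc m d = begin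
  suc (3 * c + digit (f (m + d))) ≤⟨ s≤s (+-monoʳ-≤ (3 * c) (digit≤2 (f (m + d)))) ⟩
  suc (3 * c + 2)                 ≡⟨ carry c ⟩
  3 * suc c                       ≤⟨ *-monoʳ-≤ 3 (code-upper f m d) ⟩
  3 * (3 ^ d * suc (code f m))    ≡⟨ *-assoc 3 (3 ^ d) _ ⟨
  3 ^ suc d * suc (code f m)      ∎
  where
  open ≤-Reasoning
  c : ℕ
  c = code f (m + d)
  carry : ∀ x → suc (3 * x + 2) ≡ 3 * suc x
  carry = solve-∀

code-lower : ∀ f m d → 3 ^ d * code f m ≤ code f (m + d)
code-lower f m zero rewrite +-identityʳ m = ≤-reflexive (*-identityˡ _)
code-lower f m (suc d) rewrite +-suc m d = begin
  3 ^ suc d * code f m                   ≡⟨ *-assoc 3 (3 ^ d) _ ⟩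
  3 * (3 ^ d * code f m)                 ≤⟨ *-monoʳ-≤ 3 (code-lower f m d) ⟩
  3 * code f (m + d)                     ≤⟨ m≤m+n _ _ ⟩
  3 * code f (m + d) + digit (f (m + d)) ∎
  where open ≤-Reasoning

gap-before : ∀ f n d T → code f (n + d) ≡ T → suc (3 * T) * 3 ^ n < suc (code f n) * 3 ^ suc (n + d)
gap-before f n d T code≡T = begin-strict
  suc (3 * T) * 3 ^ n      <⟨ *-monoˡ-< (3 ^ n) {{m^n≢0 3 n}} 1+3T<3[1+T] ⟩
  3 * suc T * 3 ^ n        ≤⟨ *-monoˡ-≤ (3 ^ n) (*-monoʳ-≤ 3 1+T≤) ⟩
  3 * (3 ^ d * X) * 3 ^ n  ≡⟨ regroup (3 ^ d) X (3 ^ n) ⟩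
  X * (3 * (3 ^ n * 3 ^ d)) ≡⟨ cong (λ z → X * (3 * z)) (^-distribˡ-+-* 3 n d) ⟨
  X * 3 ^ suc (n + d)      ∎
  where
  open ≤-Reasoning
  X : ℕ
  X = suc (code f n)
  1+3T<3[1+T] : suc (3 * T) < 3 * suc T
  1+3T<3[1+T] = subst (suc (3 * T) <_) (sym (*-suc 3 T)) (s≤s (s≤s (n≤1+n (3 * T))))
  1+T≤ : suc T ≤ 3 ^ d * X
  1+T≤ = subst (λ c → suc c ≤ 3 ^ d * X) code≡T (code-upper f n d)
  regroup : ∀ a x q → 3 * (a * x) * q ≡ x * (3 * (q * a))
  regroup = solve-∀

gap-after : ∀ f k d T → code f (suc k) ≡ 3 * T + 2 →
            suc (3 * T) * 3 ^ (suc k + d) < suc (code f (suc k + d)) * 3 ^ suc k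
gap-after f k d T code≡ = begin-strict
  suc (3 * T) * 3 ^ (suc k + d) ≡⟨ cong (suc (3 * T) *_) (^-distribˡ-+-* 3 (suc k) d) ⟩
  suc (3 * T) * (Z * 3 ^ d)     ≤⟨ *-monoˡ-≤ (Z * 3 ^ d) 1+3T≤2+3T ⟩
  (3 * T + 2) * (Z * 3 ^ d)     ≡⟨ regroup (3 * T + 2) Z (3 ^ d) ⟩
  3 ^ d * (3 * T + 2) * Z       ≤⟨ *-monoˡ-≤ Z lower ⟩
  code f (suc k + d) * Z        <⟨ *-monoˡ-< Z {{m^n≢0 3 (suc k)}} (n<1+n (code f (suc k + d))) ⟩
  suc (code f (suc k + d)) * Z  ∎
  where
  open ≤-Reasoning
  Z : ℕ
  Z = 3 ^ suc k
  1+3T≤2+3T : suc (3 * T) ≤ 3 * T + 2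
  1+3T≤2+3T = subst (_≤ 3 * T + 2) (+-comm (3 * T) 1) (+-monoʳ-≤ (3 * T) (s≤s z≤n))
  lower : 3 ^ d * (3 * T + 2) ≤ code f (suc k + d)
  lower = subst (λ c → 3 ^ d * c ≤ code f (suc k + d)) code≡ (code-lower f (suc k) d)
  regroup : ∀ a z b → a * (z * b) ≡ b * a * z
  regroup = solve-∀

code-gap : ∀ f k T → code f k ≡ T → code f (suc k) ≡ 3 * T + 2 →
           ∀ n → suc (3 * T) * 3 ^ n < suc (code f n) * 3 ^ suc k
code-gap f k T code≡T code≡ n with n ≤? k
... | yes n≤k with m≤n⇒∃[o]m+o≡n n≤k
...   | d , refl = gap-before f n d T code≡T
code-gap f k T code≡T code≡ n | no n≰k with m≤n⇒∃[o]m+o≡n (≰⇒> n≰k)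
...   | d , refl = gap-after f k d T code≡

num : (ℕ → Bool) → ℕ → ℕ
num f k = suc (code f k + 3 * 3 ^ k)

-- The k-th approximating graph of f, of ratio 3 + (1 + code f k)/3^k.
A : (ℕ → Bool) → ℕ → Graph
A f k = K (num f k) (3 ^ k)

3den≤num : ∀ f k → 3 ^ k + 3 ^ k + 3 ^ k ≤ num f k
3den≤num f k = ≤-trans (≤-reflexive (triple (3 ^ k))) (≤-trans (m≤n+m (3 * 3 ^ k) (code f k)) (n≤1+n _))
  where
  triple : ∀ x → x + x + x ≡ 3 * x
  triple = solve-∀

2den<num : ∀ f k → 2 * 3 ^ k < num f k
2den<num f k = s≤s (≤-trans (*-monoˡ-≤ (3 ^ k) (n≤1+n 2)) (m≤n+m (3 * 3 ^ k) (code f k)))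

hom-ratio : ∀ f g n m → Hom (A f n) (A g m) → suc (code f n) * 3 ^ m ≤ suc (code g m) * 3 ^ n
hom-ratio f g n m h = cancel (code f n) (code g m) (3 ^ n) (3 ^ m)
  (circular-bound (num f n) (3 ^ n) (num g m) (3 ^ m) (3den≤num f n) den≤num h)
  where
  den≤num : 3 ^ m ≤ num g m
  den≤num = ≤-trans (≤-trans (m≤m+n (3 ^ m) (3 ^ m)) (m≤m+n _ (3 ^ m))) (3den≤num g m)
  cancel : ∀ a b x y → (suc a + 3 * x) * y ≤ (suc b + 3 * y) * x → suc a * y ≤ suc b * x
  cancel a b x y le = +-cancelʳ-≤ (3 * (x * y)) _ _ (subst₂ _≤_ (expand a x y) (expand′ b x y) le)
    where
    expand : ∀ a x y → (suc a + 3 * x) * y ≡ suc a * y + 3 * (x * y)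
    expand = solve-∀
    expand′ : ∀ b x y → (suc b + 3 * y) * x ≡ suc b * x + 3 * (x * y)
    expand′ = solve-∀

DownSet : (ℕ → Bool) → GraphSet
DownSet f G = ∃ λ k → Hom (A f k) G

downSet-closed : ∀ f → DownwardClosed (DownSet f)
downSet-closed f G H (k , h) g = k , compose (A f k) G H h g

downSet-chromatic : ∀ f G → DownSet f G → ChromaticGreaterThan 2 G
downSet-chromatic f G (k , h) col =
  circular-not-colourable 2 (num f k) (3 ^ k) (3den≤num f k) (2den<num f k) (colour-pullback (A f k) G h col)

separated : ∀ f g k → (∀ i → i < k → f i ≡ g i) → f k ≡ true → g k ≡ false → ¬ DownSet f (A g (suc k))
separated f g k agree fk gk (n , h) = <⇒≱ gap (hom-ratio f g n (suc k) h)
  where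
  T : ℕ
  T = code g k
  f-code : code f k ≡ T
  f-code = code-prefix f g k agree
  f-code′ : code f (suc k) ≡ 3 * T + 2
  f-code′ = cong₂ (λ c b → 3 * c + digit b) f-code fk
  g-code : code g (suc k) ≡ 3 * T
  g-code = trans (cong (λ b → 3 * T + digit b) gk) (+-identityʳ (3 * T))
  gap : suc (code g (suc k)) * 3 ^ n < suc (code f n) * 3 ^ suc k
  gap = subst (λ c → suc c * 3 ^ n < suc (code f n) * 3 ^ suc k) (sym g-code) (code-gap f k T f-code f-code′ n)

agree-next : ∀ f g → SameSet (DownSet f) (DownSet g) → ∀ k → (∀ i → i < k → f i ≡ g i) → f k ≡ g k
agree-next f g same k agree with f k in fk | g k in gk
... | true  | true  = refl
... | false | false = refl
... | true  | false = ⊥-elim (separated f g k agree fk gk (proj₂ (same (A g (suc k))) (suc k , idHom (A g (suc k)))))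
... | false | true  = ⊥-elim (separated g f k (λ i i<k → sym (agree i i<k)) gk fk
                                (proj₁ (same (A f (suc k))) (suc k , idHom (A f (suc k)))))

downSet-injective : ∀ f g → SameSet (DownSet f) (DownSet g) → ∀ k → f k ≡ g k
downSet-injective f g same = <-rec (λ k → f k ≡ g k) (λ k earlier → agree-next f g same k (λ i → earlier))

mainTheorem6 : Σ ((ℕ → Bool) → GraphSet) λ F →
    ((f : ℕ → Bool) → DownwardClosed (F f) × (∀ G → F f G → ChromaticGreaterThan 2 G))
    × (∀ f g → SameSet (F f) (F g) → ∀ k → f k ≡ g k)
mainTheorem6 = DownSet , (λ f → downSet-closed f , downSet-chromatic f) , downSet-injective
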